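{- Let $d$ be a positive even integer with $m\ge 3$ distinct prime factors. Then $M(d)\le 2^{m+1}+1$. Furthermore, if $d$ is square-free, then $M(d)\le 13$ when $m=3$, and $M(d)\le 2^{m+1}+7-4m$ when $m\ge 4$.
   Context: A pair $(a,b)\in\mathbb{Z}^2$ is multiplicatively dependent if $ab\neq 0$ and there is $(k_1,k_2)\in\mathbb{Z}^2\setminus\{(0,0)\}$ with $a^{k_1}b^{k_2}=1$. For $d\in\mathbb{Z}$, $\mathcal{M}(d)$ is the set of multiplicatively dependent pairs $(a,b)\in\mathbb{Z}^2$ with $ab\ne0$ and $b-a=d$, and $M(d)=|\mathcal{M}(d)|$. -}

module Defs where

open import Data.Nat as ℕ using (ℕ; zero; suc)
open import Data.Nat.Divisibility using (_∣_)
open import Data.Nat.Primality using (Prime)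
open import Data.Integer as ℤ using (ℤ; +_; -[1+_]; 0ℤ)
open import Data.Rational as ℚ using (ℚ; 0ℚ; 1ℚ; _/_; 1/_; ≢-nonZero)
open import Data.List using (List; length)
open import Data.List.Membership.Propositional using (_∈_)
open import Data.List.Relation.Unary.Unique.Propositional using (Unique)
open import Data.List.Relation.Unary.All using (All)
open import Data.Product using (Σ; ∃; ∃₂; _×_; _,_)
open import Relation.Binary.PropositionalEquality using (_≡_; _≢_)
open import Relation.Nullary using (¬_; yes; no)

_^ℕ_ : ℚ → ℕ → ℚ
x ^ℕ zero  = 1ℚ
x ^ℕ suc n = x ℚ.* (x ^ℕ n)

-- integer powers in ℚ: x^k, with x^(-n) = (1/x)^n.
-- (For x = 0 the value is an arbitrary junk value 0; it is never used
--  below, since multiplicative dependence requires ab ≠ 0.)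
_^ℤ_ : ℚ → ℤ → ℚ
x ^ℤ k with x ℚ.≟ 0ℚ
... | yes _ = 0ℚ
x ^ℤ (+ n)     | no _  = x ^ℕ n
x ^ℤ -[1+ n ]  | no nz = ((1/ x) {{≢-nonZero nz}}) ^ℕ (suc n)

ι : ℤ → ℚ
ι a = a / 1

MultDep : ℤ → ℤ → Set
MultDep a b =
  (a ℤ.* b ≢ 0ℤ) ×
  ∃₂ λ (k₁ k₂ : ℤ) → ¬ (k₁ ≡ 0ℤ × k₂ ≡ 0ℤ) × ((ι a ^ℤ k₁) ℚ.* (ι b ^ℤ k₂) ≡ 1ℚ)

InM : ℤ → ℤ × ℤ → Set
InM d (a , b) = MultDep a b × (b ℤ.- a ≡ d)

-- |{x | P x}| ≤ N : every duplicate-free list of elements satisfying P has length ≤ N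
CardAtMost : ℕ → (ℤ × ℤ → Set) → Set
CardAtMost N P = (xs : List (ℤ × ℤ)) → Unique xs → All P xs → length xs ℕ.≤ N

HasDistinctPrimeFactors : ℕ → ℕ → Set
HasDistinctPrimeFactors n m =
  Σ (List ℕ) λ ps → Unique ps × (length ps ≡ m) ×
    ((p : ℕ) → (p ∈ ps → Prime p × p ∣ n) × (Prime p × p ∣ n → p ∈ ps))

SquareFree : ℕ → Set
SquareFree n = (p : ℕ) → Prime p → ¬ (p ℕ.* p ∣ n)

-- A multiplicatively dependent pair (a, b) with b - a = d has a = ±1, or b = ±1, or a = -b,
-- or, after possibly replacing (a, b) by (-b, -a), 2 ≤ |a| < |b| and |a| ^ p = |b| ^ q. In the
-- last case |a| = g divides b, and a = ±g, b = g (u ± 1), where d = g u with g and u coprime and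
-- g has the same prime divisors as u ± 1. Since d, having three prime factors, is not of the
-- form 2 ^ i 3 ^ j, the sign is determined by g, so these pairs are determined by the orientation
-- and the unitary divisor g, that is by a bit string of length m + 1. If d is squarefree then g ∣ u ± 1, so g ≤ u + 1: from each complementary pair
-- {g, d / g} at most one member occurs, except for a single pair with g = u + 1, whence
-- 2 ^ m + 5 pairs.
module Submission where

open import Algebra.Bundles using (CommutativeMonoid)
import Algebra.Properties.CommutativeSemigroup as CommSemigroupProperties
open import Data.Bool using (Bool; true; false; not)
import Data.Bool.Properties as BoolP
open import Data.Empty using (⊥; ⊥-elim)
open import Data.Integer as ℤ using (ℤ; +_; -[1+_]; 0ℤ; ∣_∣)
import Data.Integer.GCD as ℤGCD
import Data.Integer.Properties as ℤP
open import Data.Integer.Tactic.RingSolver using (solve-∀)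
open import Data.List using (List; []; _∷_; _++_; length; map)
open import Data.List.Membership.Propositional using (_∈_)
open import Data.List.Membership.Propositional.Properties using (∈-map⁺; ∈-++⁺ˡ; ∈-++⁺ʳ)
import Data.List.Properties as ListP
open import Data.List.Relation.Unary.All as All using (All; []; _∷_)
open import Data.List.Relation.Unary.AllPairs using (_∷_)
open import Data.List.Relation.Unary.Any using (here; there)
open import Data.List.Relation.Unary.Unique.Propositional using (Unique)
open import Data.Maybe using (Maybe; just; nothing)
open import Data.Maybe.Properties using (just-injective)
open import Data.Nat as ℕ using (ℕ; zero; suc; _+_; _*_; _∸_; _^_; _≤_; _<_; z≤n; s≤s)
open import Data.Nat.Coprimality as Coprime using (Coprime; coprime-divisor; coprime-/gcd)
open import Data.Nat.Divisibility
open import Data.Nat.DivMod using (_/_; m*[n/m]≡n)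
open import Data.Nat.GCD using (gcd; gcd[m,n]∣m; gcd[m,n]∣n)
open import Data.Nat.ListAction using (product)
open import Data.Nat.Primality
  using (Prime; euclidsLemma; prime⇒nonTrivial; prime⇒irreducible; prime?; prime[2]; ¬prime[1])
open import Data.Nat.Primality.Factorisation using (factorise)
import Data.Nat.Properties as ℕP
import Data.Nat.Tactic.RingSolver as ℕSolver
open import Data.Product using (Σ; ∃; _×_; _,_; proj₁; proj₂)
open import Data.Product.Properties using (,-injective)
open import Data.Rational as ℚ using (ℚ; mkℚ; 0ℚ; 1ℚ; 1/_; ↥_; ↧ₙ_; ≢-nonZero)
import Data.Rational.Properties as ℚP
open import Data.Sum as Sum using (_⊎_; inj₁; inj₂)
import Data.Sum.Properties as SumP
open import Data.Unit using (⊤; tt)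
open import Function using (_∘_)
open import Relation.Binary using (tri<; tri≈; tri>)
open import Relation.Binary.PropositionalEquality
open import Relation.Nullary using (¬_; Dec; yes; no; does)
open import Relation.Nullary.Decidable using (toWitness; dec-true)

open import Defs

open CommSemigroupProperties ℕP.*-commutativeSemigroup using () renaming (interchange to *-interchange)
open CommSemigroupProperties (CommutativeMonoid.commutativeSemigroup ℚP.*-1-commutativeMonoid)
  using () renaming (interchange to ℚ-*-interchange)

open ≡-Reasoning

-- Multiplicative dependence as an equation between natural powers

ι-numerator : ∀ z → ↥ ι z ≡ z
ι-numerator z = trans (sym (ℤP.*-identityʳ _))
  (subst (λ t → ↥ ι z ℤ.* t ≡ z) (ℤGCD.gcd-zeroʳ z) (ℚP.↥-/ z 1))

ι-denominator : ∀ z → ↧ₙ ι z ≡ 1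
ι-denominator z = ℤP.+-injective (trans (sym (ℤP.*-identityʳ _))
  (subst (λ t → ℚ.↧ ι z ℤ.* t ≡ + 1) (ℤGCD.gcd-zeroʳ z) (ℚP.↧-/ z 1)))

ι-injective : ∀ x y → ι x ≡ ι y → x ≡ y
ι-injective x y eq = trans (sym (ι-numerator x)) (trans (cong ↥_ eq) (ι-numerator y))

ι≡mkℚ : ∀ z → ι z ≡ mkℚ z 0 (Coprime.sym (Coprime.1-coprimeTo ∣ z ∣))
ι≡mkℚ z with ι z | ι-numerator z | ι-denominator z
... | mkℚ _ 0 _ | refl | refl = refl

-- On the normal forms with denominator 1 the product reduces by computation.
ι-homo-* : ∀ x y → ι (x ℤ.* y) ≡ ι x ℚ.* ι y
ι-homo-* x y rewrite ι≡mkℚ x | ι≡mkℚ y = refl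

ι-homo-^ : ∀ z n → ι z ^ℕ n ≡ ι (z ℤ.^ n)
ι-homo-^ z zero    = refl
ι-homo-^ z (suc n) = trans (cong (ι z ℚ.*_) (ι-homo-^ z n)) (sym (ι-homo-* z (z ℤ.^ n)))

^ℕ-distrib-* : ∀ x y n → (x ℚ.* y) ^ℕ n ≡ x ^ℕ n ℚ.* y ^ℕ n
^ℕ-distrib-* x y zero    = refl
^ℕ-distrib-* x y (suc n) = trans (cong ((x ℚ.* y) ℚ.*_) (^ℕ-distrib-* x y n)) (ℚ-*-interchange x y (x ^ℕ n) (y ^ℕ n))

1^ℕ : ∀ n → 1ℚ ^ℕ n ≡ 1ℚ
1^ℕ zero    = refl
1^ℕ (suc n) = trans (ℚP.*-identityˡ (1ℚ ^ℕ n)) (1^ℕ n)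

inverse-unique : ∀ {x y z} → x ℚ.* y ≡ 1ℚ → y ℚ.* z ≡ 1ℚ → x ≡ z
inverse-unique {x} {y} {z} xy≡1 yz≡1 = begin
  x               ≡⟨ sym (ℚP.*-identityʳ x) ⟩
  x ℚ.* 1ℚ        ≡⟨ cong (x ℚ.*_) (sym yz≡1) ⟩
  x ℚ.* (y ℚ.* z) ≡⟨ sym (ℚP.*-assoc x y z) ⟩
  (x ℚ.* y) ℚ.* z ≡⟨ cong (ℚ._* z) xy≡1 ⟩
  1ℚ ℚ.* z        ≡⟨ ℚP.*-identityˡ z ⟩
  z               ∎

module _ {x : ℚ} (x≢0 : x ≢ 0ℚ) where

  ^ℤ-+ : ∀ n → x ^ℤ (+ n) ≡ x ^ℕ n
  ^ℤ-+ n with x ℚ.≟ 0ℚ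
  ... | yes x≡0 = ⊥-elim (x≢0 x≡0)
  ... | no _    = refl

  ^ℤ-inverse : ∀ n → x ^ℤ -[1+ n ] ℚ.* x ^ℕ suc n ≡ 1ℚ
  ^ℤ-inverse n with x ℚ.≟ 0ℚ
  ... | yes x≡0 = ⊥-elim (x≢0 x≡0)
  ... | no x≢0′ = begin
    y ^ℕ suc n ℚ.* x ^ℕ suc n ≡⟨ sym (^ℕ-distrib-* y x (suc n)) ⟩
    (y ℚ.* x) ^ℕ suc n        ≡⟨ cong (_^ℕ suc n) (ℚP.*-inverseˡ x {{≢-nonZero x≢0′}}) ⟩
    1ℚ ^ℕ suc n               ≡⟨ 1^ℕ (suc n) ⟩
    1ℚ                        ∎
    where y = (1/ x) {{≢-nonZero x≢0′}}

∣^∣ : ∀ z n → ∣ z ℤ.^ n ∣ ≡ ∣ z ∣ ^ n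
∣^∣ z zero    = refl
∣^∣ z (suc n) = trans (ℤP.abs-* z (z ℤ.^ n)) (cong (∣ z ∣ *_) (∣^∣ z n))

ι-^-injective : ∀ a b n k → ι a ^ℕ n ≡ ι b ^ℕ k → ∣ a ∣ ^ n ≡ ∣ b ∣ ^ k
ι-^-injective a b n k eq = begin
  ∣ a ∣ ^ n     ≡⟨ sym (∣^∣ a n) ⟩
  ∣ a ℤ.^ n ∣   ≡⟨ cong ∣_∣ (ι-injective (a ℤ.^ n) (b ℤ.^ k) ι[aⁿ]≡ι[bᵏ]) ⟩
  ∣ b ℤ.^ k ∣   ≡⟨ ∣^∣ b k ⟩
  ∣ b ∣ ^ k     ∎
  where
  ι[aⁿ]≡ι[bᵏ] : ι (a ℤ.^ n) ≡ ι (b ℤ.^ k)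
  ι[aⁿ]≡ι[bᵏ] = trans (sym (ι-homo-^ a n)) (trans eq (ι-homo-^ b k))

ι-^-*-^≡1 : ∀ a b n k → ι a ^ℕ n ℚ.* ι b ^ℕ k ≡ 1ℚ → ∣ a ∣ ^ n * ∣ b ∣ ^ k ≡ 1
ι-^-*-^≡1 a b n k eq = begin
  ∣ a ∣ ^ n * ∣ b ∣ ^ k          ≡⟨ sym (cong₂ _*_ (∣^∣ a n) (∣^∣ b k)) ⟩
  ∣ a ℤ.^ n ∣ * ∣ b ℤ.^ k ∣      ≡⟨ sym (ℤP.abs-* (a ℤ.^ n) (b ℤ.^ k)) ⟩
  ∣ a ℤ.^ n ℤ.* b ℤ.^ k ∣        ≡⟨ cong ∣_∣ (ι-injective (a ℤ.^ n ℤ.* b ℤ.^ k) (+ 1) ι[aⁿbᵏ]≡1) ⟩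
  1                              ∎
  where
  ι[aⁿbᵏ]≡1 : ι (a ℤ.^ n ℤ.* b ℤ.^ k) ≡ ι (+ 1)
  ι[aⁿbᵏ]≡1 = trans (ι-homo-* (a ℤ.^ n) (b ℤ.^ k))
               (trans (sym (cong₂ ℚ._*_ (ι-homo-^ a n) (ι-homo-^ b k))) eq)

data Dependence (A B : ℕ) : Set where
  unitˡ  : A ≡ 1 → Dependence A B
  unitʳ  : B ≡ 1 → Dependence A B
  powers : ∀ p q → A ^ suc p ≡ B ^ suc q → Dependence A B

dependence-sym : ∀ {A B} → Dependence A B → Dependence B A
dependence-sym (unitˡ A≡1)       = unitʳ A≡1
dependence-sym (unitʳ B≡1)       = unitˡ B≡1
dependence-sym (powers p q eq)   = powers q p (sym eq)

^*^≡1⇒dependence : ∀ {A B} n k → ¬ (n ≡ 0 × k ≡ 0) → A ^ n * B ^ k ≡ 1 → Dependence A B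
^*^≡1⇒dependence {A} {B} (suc n) k _ eq = unitˡ (ℕP.m*n≡1⇒m≡1 A _ (ℕP.m*n≡1⇒m≡1 _ (B ^ k) eq))
^*^≡1⇒dependence {A} {B} zero (suc k) _ eq = unitʳ (ℕP.m*n≡1⇒m≡1 B _ (ℕP.m*n≡1⇒n≡1 1 _ eq))
^*^≡1⇒dependence zero zero nontrivial _ = ⊥-elim (nontrivial (refl , refl))

^≡^⇒dependence : ∀ {A B} n k → A ^ n ≡ B ^ suc k → Dependence A B
^≡^⇒dependence {B = B} zero    k eq = unitʳ (ℕP.m*n≡1⇒m≡1 B _ (sym eq))
^≡^⇒dependence         (suc n) k eq = powers n k eq

multDep⇒dependence : ∀ {a b} → MultDep a b → Dependence ∣ a ∣ ∣ b ∣
multDep⇒dependence {a} {b} (ab≢0 , k₁ , k₂ , nontrivial , eq) = go k₁ k₂ nontrivial eq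
  where
  a≢0 : ι a ≢ 0ℚ
  a≢0 ιa≡0 = ab≢0 (cong (ℤ._* b) (ι-injective a 0ℤ ιa≡0))
  b≢0 : ι b ≢ 0ℚ
  b≢0 ιb≡0 = ab≢0 (trans (cong (a ℤ.*_) (ι-injective b 0ℤ ιb≡0)) (ℤP.*-zeroʳ a))
  go : ∀ k₁ k₂ → ¬ (k₁ ≡ 0ℤ × k₂ ≡ 0ℤ) → ι a ^ℤ k₁ ℚ.* ι b ^ℤ k₂ ≡ 1ℚ →
       Dependence ∣ a ∣ ∣ b ∣
  go (+ n) (+ k) nontrivial eq = ^*^≡1⇒dependence n k (λ (n≡0 , k≡0) → nontrivial (cong +_ n≡0 , cong +_ k≡0))
    (ι-^-*-^≡1 a b n k (subst₂ (λ x y → x ℚ.* y ≡ 1ℚ) (^ℤ-+ a≢0 n) (^ℤ-+ b≢0 k) eq))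
  go (+ n) -[1+ k ] _ eq = ^≡^⇒dependence n k (ι-^-injective a b n (suc k)
    (inverse-unique (subst (λ x → x ℚ.* _ ≡ 1ℚ) (^ℤ-+ a≢0 n) eq) (^ℤ-inverse b≢0 k)))
  go -[1+ n ] (+ k) _ eq = dependence-sym (^≡^⇒dependence k n (ι-^-injective b a k (suc n)
    (inverse-unique (subst (λ y → y ℚ.* ι a ^ℤ -[1+ n ] ≡ 1ℚ) (^ℤ-+ b≢0 k)
                      (trans (ℚP.*-comm (ι b ^ℤ (+ k)) (ι a ^ℤ -[1+ n ])) eq))
                    (^ℤ-inverse a≢0 n))))
  go -[1+ n ] -[1+ k ] _ eq = ^*^≡1⇒dependence (suc n) (suc k) (λ ()) (ι-^-*-^≡1 a b (suc n) (suc k)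
    (trans (cong (ι a ^ℕ suc n ℚ.*_) (sym (inverse-unique eq (^ℤ-inverse b≢0 k))))
           (trans (ℚP.*-comm (ι a ^ℕ suc n) (ι a ^ℤ -[1+ n ])) (^ℤ-inverse a≢0 n))))

prime≥2 : ∀ {p} → Prime p → 2 ≤ p
prime≥2 {p} pr = ℕ.nonTrivial⇒n>1 p {{prime⇒nonTrivial pr}}

prime∤1 : ∀ {p} → Prime p → ¬ p ∣ 1
prime∤1 pr p∣1 = ℕP.<⇒≢ (prime≥2 pr) (sym (∣1⇒≡1 p∣1))

primeFactor : ∀ n → 2 ≤ n → ∃ λ p → Prime p × p ∣ n
primeFactor 1 (s≤s ())
primeFactor (suc (suc k)) _ with factorise (suc (suc k))
... | record { factors = [] ; isFactorisation = () }
... | record { factors = p ∷ ps ; isFactorisation = n≡Π ; factorsPrime = pr ∷ _ } =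
  p , pr , subst (p ∣_) (sym n≡Π) (m∣m*n (product ps))

noCommonPrime⇒coprime : ∀ {m n} → 1 ≤ m → (∀ p → Prime p → p ∣ m → p ∣ n → ⊥) → Coprime m n
noCommonPrime⇒coprime 1≤m _ {0} (0∣m , _) = ⊥-elim (ℕP.<⇒≢ 1≤m (sym (0∣⇒≡0 0∣m)))
noCommonPrime⇒coprime _ _ {1} _ = refl
noCommonPrime⇒coprime _ noCommon {suc (suc j)} (i∣m , i∣n) with primeFactor (suc (suc j)) (s≤s (s≤s z≤n))
... | p , pr , p∣i = ⊥-elim (noCommon p pr (∣-trans p∣i i∣m) (∣-trans p∣i i∣n))

prime∣^⇒∣ : ∀ {p m} n → Prime p → p ∣ m ^ n → p ∣ m
prime∣^⇒∣ zero pr p∣1 = ⊥-elim (prime∤1 pr p∣1)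
prime∣^⇒∣ {m = m} (suc n) pr p∣m^suc[n] with euclidsLemma m (m ^ n) pr p∣m^suc[n]
... | inj₁ p∣m   = p∣m
... | inj₂ p∣m^n = prime∣^⇒∣ n pr p∣m^n

^-distribʳ-* : ∀ m n k → (m * n) ^ k ≡ m ^ k * n ^ k
^-distribʳ-* m n zero    = refl
^-distribʳ-* m n (suc k) = trans (cong (m * n *_) (^-distribʳ-* m n k)) (*-interchange m n (m ^ k) (n ^ k))

coprime∧∣^⇒≡1 : ∀ {m n} k → Coprime m n → m ∣ n ^ k → m ≡ 1
coprime∧∣^⇒≡1 zero    _      m∣1        = ∣1⇒≡1 m∣1
coprime∧∣^⇒≡1 (suc k) coprime m∣n^suc[k] = coprime∧∣^⇒≡1 k coprime (coprime-divisor coprime m∣n^suc[k])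

-- Dividing out h = gcd m n leaves coprime m′ and n′ with m′ ^ k ∣ n′ ^ k, forcing m′ = 1.
^∣^⇒∣ : ∀ {m n} k → 1 ≤ m → m ^ suc k ∣ n ^ suc k → m ∣ n
^∣^⇒∣ {m} {n} k 1≤m m^k∣n^k = subst (_∣ n) (sym m≡h) (gcd[m,n]∣n m n)
  where
  h = gcd m n
  instance
    h≢0 : ℕ.NonZero h
    h≢0 = ℕ.≢-nonZero λ h≡0 → ℕP.<⇒≢ 1≤m (sym (0∣⇒≡0 (subst (_∣ m) h≡0 (gcd[m,n]∣m m n))))
    h^k≢0 : ℕ.NonZero (h ^ suc k)
    h^k≢0 = ℕP.m^n≢0 h (suc k)
  m′ = m / h
  n′ = n / h
  h*m′≡m : h * m′ ≡ m
  h*m′≡m = m*[n/m]≡n (gcd[m,n]∣m m n)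
  h*n′≡n : h * n′ ≡ n
  h*n′≡n = m*[n/m]≡n (gcd[m,n]∣n m n)
  m′∣n′^k : m′ ∣ n′ ^ suc k
  m′∣n′^k = ∣-trans (m∣m*n (m′ ^ k)) (*-cancelˡ-∣ (h ^ suc k)
    (subst₂ _∣_ (trans (cong (_^ suc k) (sym h*m′≡m)) (^-distribʳ-* h m′ (suc k)))
                (trans (cong (_^ suc k) (sym h*n′≡n)) (^-distribʳ-* h n′ (suc k))) m^k∣n^k))
  m≡h : m ≡ h
  m≡h = trans (sym h*m′≡m)
    (trans (cong (h *_) (coprime∧∣^⇒≡1 (suc k) (coprime-/gcd m n) m′∣n′^k)) (ℕP.*-identityʳ h))

-- Squarefreeness makes each prime factor q coprime to the product of the others.
product-∣ : ∀ {w} qs → All Prime qs → SquareFree (product qs) → (∀ p → Prime p → p ∣ product qs → p ∣ w) →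
            product qs ∣ w
product-∣ {w} []       _          _   _   = 1∣ w
product-∣ {w} (q ∷ qs) (pr ∷ prs) sqf rad with product-∣ qs prs (λ p pr p*p∣Π → sqf p pr (∣n⇒∣m*n q p*p∣Π))
                                              (λ p pr p∣Π → rad p pr (∣n⇒∣m*n q p∣Π))
... | divides k refl with euclidsLemma k (product qs) pr (rad q pr (m∣m*n (product qs)))
...   | inj₁ q∣k = *-monoˡ-∣ (product qs) q∣k
...   | inj₂ q∣Π = ⊥-elim (sqf q pr (*-monoʳ-∣ q q∣Π))

squarefree-∣ : ∀ {g w} → .{{ℕ.NonZero g}} → SquareFree g → (∀ p → Prime p → p ∣ g → p ∣ w) → g ∣ w
squarefree-∣ {g} sqf rad with factorise g
... | record { factors = qs ; isFactorisation = refl ; factorsPrime = prs } = product-∣ qs prs sqf rad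

SameRadical : ℕ → ℕ → Set
SameRadical m n = ∀ p → Prime p → (p ∣ m → p ∣ n) × (p ∣ n → p ∣ m)

^≡^⇒sameRadical : ∀ {m n} i j → m ^ suc i ≡ n ^ suc j → SameRadical m n
^≡^⇒sameRadical {m} {n} i j eq p pr =
  (λ p∣m → prime∣^⇒∣ (suc j) pr (subst (p ∣_) eq (∣m⇒∣m*n (m ^ i) p∣m))) ,
  (λ p∣n → prime∣^⇒∣ (suc i) pr (subst (p ∣_) (sym eq) (∣m⇒∣m*n (n ^ j) p∣n)))

-- From g < B the exponents satisfy q < p, so g ^ (1+q) ∣ B ^ (1+q) and g ∣ B; writing
-- B = g * w and cancelling g ^ (1+q) leaves g ^ (p-q) = w ^ (1+q).
perfectPower⇒multiple : ∀ {g B} p q → 2 ≤ g → g < B → g ^ suc p ≡ B ^ suc q →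
                        ∃ λ w → B ≡ g * w × SameRadical g w
perfectPower⇒multiple {g} {B} p q 2≤g g<B eq with ℕ.suc q ℕ.≤? p
... | no q≮p = ⊥-elim (ℕP.<⇒≱ (ℕP.^-monoˡ-< (suc q) g<B)
                 (subst (_≤ g ^ suc q) eq (ℕP.^-monoʳ-≤ g (s≤s (ℕP.≮⇒≥ q≮p)))))
  where instance _ = ℕ.>-nonZero (ℕP.<⇒≤ 2≤g)
... | yes q<p with ℕP.m≤n⇒∃[o]m+o≡n q<p
...   | k , refl = w , B≡g*w , ^≡^⇒sameRadical k q g^k≡w^q
  where
  instance _ = ℕP.m^n≢0 g (suc q) {{ℕ.>-nonZero (ℕP.<⇒≤ 2≤g)}}
  g^p≡g^q*g^k : g ^ suc (suc q + k) ≡ g ^ suc q * g ^ suc k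
  g^p≡g^q*g^k = trans (cong (g ^_) (sym (ℕP.+-suc (suc q) k))) (ℕP.^-distribˡ-+-* g (suc q) (suc k))
  g∣B : g ∣ B
  g∣B = ^∣^⇒∣ q (ℕP.<⇒≤ 2≤g) (divides (g ^ suc k)
          (trans (sym eq) (trans g^p≡g^q*g^k (ℕP.*-comm (g ^ suc q) (g ^ suc k)))))
  w = quotient g∣B
  B≡g*w : B ≡ g * w
  B≡g*w = m∣n⇒n≡m*quotient g∣B
  g^k≡w^q : g ^ suc k ≡ w ^ suc q
  g^k≡w^q = ℕP.*-cancelˡ-≡ (g ^ suc k) (w ^ suc q) (g ^ suc q)
    (trans (sym g^p≡g^q*g^k) (trans eq (trans (cong (_^ suc q) B≡g*w) (^-distribʳ-* g w (suc q)))))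

prime[3] : Prime 3
prime[3] = toWitness {a? = prime? 3} tt

prime∣prime⇒≡ : ∀ {p q} → Prime p → Prime q → p ∣ q → p ≡ q
prime∣prime⇒≡ pr-p pr-q p∣q with prime⇒irreducible pr-q p∣q
... | inj₁ refl = ⊥-elim (¬prime[1] pr-p)
... | inj₂ p≡q  = p≡q

AllPrimeFactors : (ℕ → Set) → ℕ → Set
AllPrimeFactors P n = ∀ p → Prime p → p ∣ n → P p

3-Smooth : ℕ → Set
3-Smooth = AllPrimeFactors (λ p → p ≡ 2 ⊎ p ≡ 3)

allPrimeFactors-∣ : ∀ {P m n} → m ∣ n → AllPrimeFactors P n → AllPrimeFactors P m
allPrimeFactors-∣ m∣n all p pr p∣m = all p pr (∣-trans p∣m m∣n)

odd-powerOf2⇒≡1 : ∀ {n} → 1 ≤ n → AllPrimeFactors (_≡ 2) n → ¬ 2 ∣ n → n ≡ 1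
odd-powerOf2⇒≡1 {1} _ _ _ = refl
odd-powerOf2⇒≡1 {suc (suc k)} _ all 2∤n with primeFactor (suc (suc k)) (s≤s (s≤s z≤n))
... | p , pr , p∣n = ⊥-elim (2∤n (subst (_∣ suc (suc k)) (all p pr p∣n) p∣n))

-- Of two consecutive powers of two one is odd, hence 1; so the only powers of two at distance 2 are 2 and 4.
powersOf2-gap2 : ∀ {n} → 1 ≤ n → AllPrimeFactors (_≡ 2) n → AllPrimeFactors (_≡ 2) (n + 2) → n ≡ 2
powersOf2-gap2 {n} 1≤n pow pow+2 with 2 ∣? n
... | no 2∤n = ⊥-elim (3≢2 (pow+2 3 prime[3] (subst (3 ∣_) (cong (_+ 2) (sym n≡1)) ∣-refl)))
  where
  n≡1 : n ≡ 1
  n≡1 = odd-powerOf2⇒≡1 1≤n pow 2∤n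
  3≢2 : 3 ≢ 2
  3≢2 ()
... | yes (divides s refl) = cong (_* 2) s≡1
  where
  1≤s : 1 ≤ s
  1≤s = ℕP.n≢0⇒n>0 λ { refl → ℕP.<⇒≢ 1≤n refl }
  pow-s : AllPrimeFactors (_≡ 2) s
  pow-s = allPrimeFactors-∣ (m∣m*n 2) pow
  pow-s+1 : AllPrimeFactors (_≡ 2) (s + 1)
  pow-s+1 = allPrimeFactors-∣ (divides 2 (trans (sym (ℕP.*-distribʳ-+ 2 s 1)) (ℕP.*-comm (s + 1) 2))) pow+2
  s≡1 : s ≡ 1
  s≡1 with 2 ∣? s
  ... | no 2∤s  = odd-powerOf2⇒≡1 1≤s pow-s 2∤s
  ... | yes 2∣s = ⊥-elim (ℕP.<⇒≢ 1≤s (sym (ℕP.+-cancelʳ-≡ 1 s 0 (odd-powerOf2⇒≡1 (ℕP.m≤n+m 1 s) pow-s+1 2∤s+1))))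
    where
    2∤s+1 : ¬ 2 ∣ s + 1
    2∤s+1 2∣s+1 = prime∤1 prime[2] (∣m+n∣m⇒∣n 2∣s+1 2∣s)

-- Each prime of g divides both n and n + 2, hence 2; so n and n + 2 are powers of two, n = 2.
sameRadical-gap2⇒3-smooth : ∀ {g n} → 1 ≤ n → SameRadical g n → SameRadical g (n + 2) → 3-Smooth (g * (n + 1))
sameRadical-gap2⇒3-smooth {g} {n} 1≤n rad-n rad-n+2 p pr p∣g*[n+1] =
  Sum.map (powerOf2-g p pr) (λ p∣n+1 → prime∣prime⇒≡ pr prime[3] (subst (λ k → p ∣ k + 1) n≡2 p∣n+1))
          (euclidsLemma g (n + 1) pr p∣g*[n+1])
  where
  powerOf2-g : AllPrimeFactors (_≡ 2) g
  powerOf2-g p pr p∣g =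
    prime∣prime⇒≡ pr prime[2] (∣m+n∣m⇒∣n (proj₁ (rad-n+2 p pr) p∣g) (proj₁ (rad-n p pr) p∣g))
  n≡2 : n ≡ 2
  n≡2 = powersOf2-gap2 1≤n (λ p pr p∣n → powerOf2-g p pr (proj₂ (rad-n p pr) p∣n))
                          (λ p pr p∣n+2 → powerOf2-g p pr (proj₂ (rad-n+2 p pr) p∣n+2))

suc[m]*m-injective : ∀ {m n} → suc m * m ≡ suc n * n → m ≡ n
suc[m]*m-injective {m} {n} eq with ℕP.<-cmp m n
... | tri< m<n _ _ = ⊥-elim (ℕP.<⇒≢ (ℕP.*-mono-< (s≤s m<n) m<n) eq)
... | tri≈ _ m≡n _ = m≡n
... | tri> _ _ n<m = ⊥-elim (ℕP.<⇒≢ (ℕP.*-mono-< (s≤s n<m) n<m) (sym eq))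

within-one⇒≡ : ∀ {m n} → m ≤ suc n → m ≢ suc n → n ≤ suc m → n ≢ suc m → m ≡ n
within-one⇒≡ m≤1+n m≢1+n n≤1+m n≢1+m =
  ℕP.≤-antisym (ℕP.≤-pred (ℕP.≤∧≢⇒< m≤1+n m≢1+n)) (ℕP.≤-pred (ℕP.≤∧≢⇒< n≤1+m n≢1+m))

-- Pairs of multiplicatively dependent integers at distance d

-- The reflection (a, b) ↦ (-b, -a) preserves b - a and exchanges |a| and |b|.
orient : Bool → ℤ × ℤ → ℤ × ℤ
orient true  x       = x
orient false (a , b) = ℤ.- b , ℤ.- a

orient-injective : ∀ t {x y} → orient t x ≡ orient t y → x ≡ y
orient-injective true  eq = eq
orient-injective false {a , b} {a′ , b′} eq =
  cong₂ _,_ (ℤP.neg-injective (cong proj₂ eq)) (ℤP.neg-injective (cong proj₁ eq))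

b-a≡d⇒b≡a+d : ∀ a b {d} → b ℤ.- a ≡ d → b ≡ a ℤ.+ d
b-a≡d⇒b≡a+d a b refl = b≡a+[b-a] a b
  where
  b≡a+[b-a] : ∀ a b → b ≡ a ℤ.+ (b ℤ.- a)
  b≡a+[b-a] = solve-∀

data Shape (g u : ℕ) : ℤ × ℤ → Set where
  plus  : SameRadical g (suc u)  → Shape g u (+ g , + (g * suc u))
  minus : SameRadical g (u ∸ 1) → Shape g u (ℤ.- (+ g) , + (g * (u ∸ 1)))

record PowerPair (d : ℕ) (x : ℤ × ℤ) : Set where
  field
    g u     : ℕ
    2≤g     : 2 ≤ g
    2≤u     : 2 ≤ u
    d≡g*u   : d ≡ g * u
    coprime : Coprime g u
    shape   : Shape g u x

plusPowerPair : ∀ {d g w} → 1 ≤ d → ¬ 3-Smooth d → 2 ≤ g → g + d ≡ g * w → SameRadical g w →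
                PowerPair d (+ g , + (g * w))
plusPowerPair {d} {g} {zero} _ _ 2≤g g+d≡0 _ =
  ⊥-elim (ℕP.<⇒≢ (ℕP.<⇒≤ 2≤g) (sym (ℕP.m+n≡0⇒m≡0 g (trans g+d≡0 (ℕP.*-zeroʳ g)))))
plusPowerPair {d} {g} {1} 1≤d _ _ g+d≡g*1 _ =
  ⊥-elim (ℕP.<⇒≢ 1≤d (sym (ℕP.+-cancelˡ-≡ g d 0
    (trans g+d≡g*1 (trans (ℕP.*-identityʳ g) (sym (ℕP.+-identityʳ g)))))))
plusPowerPair {d} {g} {2} _ ¬smooth _ g+d≡g*2 rad = ⊥-elim (¬smooth λ p pr p∣d →
  inj₁ (prime∣prime⇒≡ pr prime[2] (proj₁ (rad p pr) (subst (p ∣_) d≡g p∣d))))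
  where
  d≡g : d ≡ g
  d≡g = ℕP.+-cancelˡ-≡ g d g (trans g+d≡g*2 (trans (ℕP.*-suc g 1) (cong (λ k → g + k) (ℕP.*-identityʳ g))))
plusPowerPair {d} {g} {suc u@(suc (suc _))} _ _ 2≤g g+d≡g*[1+u] rad = record
  { g = g ; u = u ; 2≤g = 2≤g ; 2≤u = s≤s (s≤s z≤n) ; d≡g*u = d≡g*u ; coprime = coprime ; shape = plus rad }
  where
  d≡g*u : d ≡ g * u
  d≡g*u = ℕP.+-cancelˡ-≡ g d (g * u) (trans g+d≡g*[1+u] (ℕP.*-suc g u))
  coprime : Coprime g u
  coprime = noCommonPrime⇒coprime (ℕP.<⇒≤ 2≤g) λ p pr p∣g p∣u →
    prime∤1 pr (∣m+n∣m⇒∣n (subst (p ∣_) (ℕP.+-comm 1 u) (proj₁ (rad p pr) p∣g)) p∣u)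

minusPowerPair : ∀ {d g w} → 1 ≤ w → 2 ≤ g → g * w + g ≡ d → SameRadical g w →
                 PowerPair d (ℤ.- (+ g) , + (g * w))
minusPowerPair {d} {g} {suc w} _ 2≤g g*w+g≡d rad = record
  { g = g ; u = suc (suc w) ; 2≤g = 2≤g ; 2≤u = s≤s (s≤s z≤n) ; d≡g*u = d≡g*u ; coprime = coprime
  ; shape = minus rad }
  where
  d≡g*u : d ≡ g * suc (suc w)
  d≡g*u = trans (sym g*w+g≡d) (trans (ℕP.+-comm (g * suc w) g) (sym (ℕP.*-suc g (suc w))))
  coprime : Coprime g (suc (suc w))
  coprime = noCommonPrime⇒coprime (ℕP.<⇒≤ 2≤g) λ p pr p∣g p∣u →
    prime∤1 pr (∣m+n∣m⇒∣n (subst (p ∣_) (ℕP.+-comm 1 (suc w)) p∣u) (proj₁ (rad p pr) p∣g))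

powerPair : ∀ {d a b} p q → 1 ≤ d → ¬ 3-Smooth d → b ℤ.- a ≡ + d →
            2 ≤ ∣ a ∣ → ∣ a ∣ < ∣ b ∣ → ∣ a ∣ ^ suc p ≡ ∣ b ∣ ^ suc q → PowerPair d (a , b)
powerPair {a = + g} {+ B} p q 1≤d ¬smooth b-a≡d 2≤g g<B eq with perfectPower⇒multiple p q 2≤g g<B eq
... | w , refl , rad = plusPowerPair 1≤d ¬smooth 2≤g (ℤP.+-injective (sym (b-a≡d⇒b≡a+d (+ g) (+ (g * w)) b-a≡d))) rad
powerPair {a = -[1+ n ]} {+ B} p q _ _ b-a≡d 2≤g g<B eq with perfectPower⇒multiple p q 2≤g g<B eq
... | w , refl , rad = minusPowerPair (1≤w w g<B) 2≤g (ℤP.+-injective b-a≡d) rad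
  where
  1≤w : ∀ w → suc n < suc n * w → 1 ≤ w
  1≤w zero    g<0 = ⊥-elim (ℕP.<⇒≱ g<0 (ℕP.≤-trans (ℕP.≤-reflexive (ℕP.*-zeroʳ (suc n))) z≤n))
  1≤w (suc _) _   = s≤s z≤n
powerPair {a = + g} { -[1+ k ]} p q _ _ b-a≡d _ _ _ with () ← b-a≡d⇒b≡a+d (+ g) -[1+ k ] b-a≡d
powerPair {d} { -[1+ n ]} { -[1+ k ]} p q _ _ b-a≡d _ b<a _
  with subst (-[1+ n ] ℤ.≤_) (sym (b-a≡d⇒b≡a+d -[1+ n ] -[1+ k ] b-a≡d)) (ℤP.i≤i+j -[1+ n ] (+ d))
... | ℤ.-≤- k≤n = ⊥-elim (ℕP.<⇒≱ b<a (s≤s k≤n))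

2≤∣∣ : ∀ i → i ≢ 0ℤ → ∣ i ∣ ≢ 1 → 2 ≤ ∣ i ∣
2≤∣∣ (+ 0)             i≢0 _     = ⊥-elim (i≢0 refl)
2≤∣∣ (+ 1)             _   ∣i∣≢1 = ⊥-elim (∣i∣≢1 refl)
2≤∣∣ (+ suc (suc _))   _   _     = s≤s (s≤s z≤n)
2≤∣∣ -[1+ 0 ]          _   ∣i∣≢1 = ⊥-elim (∣i∣≢1 refl)
2≤∣∣ -[1+ suc _ ]      _   _     = s≤s (s≤s z≤n)

±1 : Bool → ℤ
±1 true  = + 1
±1 false = -[1+ 0 ]

∣i∣≡1⇒i≡±1 : ∀ i → ∣ i ∣ ≡ 1 → ∃ λ s → i ≡ ±1 s
∣i∣≡1⇒i≡±1 (+ .1)     refl = true , refl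
∣i∣≡1⇒i≡±1 -[1+ .0 ]  refl = false , refl

∣i∣≡∣j∣⇒i≡j∨i≡-j : ∀ i j → ∣ i ∣ ≡ ∣ j ∣ → i ≡ j ⊎ i ≡ ℤ.- j
∣i∣≡∣j∣⇒i≡j∨i≡-j (+ n)     (+ .n)          refl = inj₁ refl
∣i∣≡∣j∣⇒i≡j∨i≡-j (+ .(suc m)) -[1+ m ]     refl = inj₂ refl
∣i∣≡∣j∣⇒i≡j∨i≡-j -[1+ n ]  (+ .(suc n))    refl = inj₂ refl
∣i∣≡∣j∣⇒i≡j∨i≡-j -[1+ n ]  -[1+ .n ]       refl = inj₁ refl

data Trivial (x : ℤ × ℤ) : Set where
  unitFirst  : (s : Bool) → proj₁ x ≡ ±1 s → Trivial x
  unitSecond : (s : Bool) → proj₂ x ≡ ±1 s → Trivial x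
  opposite   : proj₁ x ≡ ℤ.- proj₂ x → Trivial x

data Kind (d : ℕ) (x : ℤ × ℤ) : Set where
  trivial : Trivial x → Kind d x
  power   : (t : Bool) → PowerPair d (orient t x) → Kind d x

classify : ∀ {d} x → 1 ≤ d → ¬ 3-Smooth d → InM (+ d) x → Kind d x
classify {d} (a , b) 1≤d ¬smooth ((ab≢0 , dependent) , b-a≡d)
  with ∣ a ∣ ℕ.≟ 1 | ∣ b ∣ ℕ.≟ 1 | multDep⇒dependence {a} {b} (ab≢0 , dependent)
... | yes ∣a∣≡1 | _         | _ = let s , a≡±1 = ∣i∣≡1⇒i≡±1 a ∣a∣≡1 in trivial (unitFirst s a≡±1)
... | no _      | yes ∣b∣≡1 | _ = let s , b≡±1 = ∣i∣≡1⇒i≡±1 b ∣b∣≡1 in trivial (unitSecond s b≡±1)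
... | no ∣a∣≢1  | no _      | unitˡ ∣a∣≡1 = ⊥-elim (∣a∣≢1 ∣a∣≡1)
... | no _      | no ∣b∣≢1  | unitʳ ∣b∣≡1 = ⊥-elim (∣b∣≢1 ∣b∣≡1)
... | no ∣a∣≢1  | no ∣b∣≢1  | powers p q eq with ℕP.<-cmp ∣ a ∣ ∣ b ∣
...   | tri< ∣a∣<∣b∣ _ _ =
  power true (powerPair p q 1≤d ¬smooth b-a≡d (2≤∣∣ a a≢0 ∣a∣≢1) ∣a∣<∣b∣ eq)
  where
  a≢0 : a ≢ 0ℤ
  a≢0 a≡0 = ab≢0 (cong (ℤ._* b) a≡0)
...   | tri> _ _ ∣b∣<∣a∣ = power false (powerPair q p 1≤d ¬smooth reflect-diff
          (subst (2 ≤_) (sym (ℤP.∣-i∣≡∣i∣ b)) (2≤∣∣ b b≢0 ∣b∣≢1))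
          (subst₂ _<_ (sym (ℤP.∣-i∣≡∣i∣ b)) (sym (ℤP.∣-i∣≡∣i∣ a)) ∣b∣<∣a∣)
          (subst₂ (λ m n → m ^ suc q ≡ n ^ suc p) (sym (ℤP.∣-i∣≡∣i∣ b)) (sym (ℤP.∣-i∣≡∣i∣ a)) (sym eq)))
  where
  b≢0 : b ≢ 0ℤ
  b≢0 b≡0 = ab≢0 (trans (cong (a ℤ.*_) b≡0) (ℤP.*-zeroʳ a))
  reflect-diff : ℤ.- a ℤ.- ℤ.- b ≡ + d
  reflect-diff = trans (diff-reflect a b) b-a≡d
    where diff-reflect : ∀ a b → ℤ.- a ℤ.- ℤ.- b ≡ b ℤ.- a
          diff-reflect = solve-∀
...   | tri≈ _ ∣a∣≡∣b∣ _ with ∣i∣≡∣j∣⇒i≡j∨i≡-j a b ∣a∣≡∣b∣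
...     | inj₂ a≡-b = trivial (opposite a≡-b)
...     | inj₁ refl = ⊥-elim (ℕP.<⇒≢ 1≤d (sym (ℤP.+-injective (trans (sym b-a≡d) (ℤP.+-inverseʳ a)))))

pair-by-first : ∀ {d a b a′ b′} → b ℤ.- a ≡ d → b′ ℤ.- a′ ≡ d → a ≡ a′ → (a , b) ≡ (a′ , b′)
pair-by-first {a = a} {b} {b′ = b′} b-a≡d b′-a≡d refl =
  cong (a ,_) (trans (b-a≡d⇒b≡a+d a b b-a≡d) (sym (b-a≡d⇒b≡a+d a b′ b′-a≡d)))

pair-by-second : ∀ {d a b a′ b′} → b ℤ.- a ≡ d → b′ ℤ.- a′ ≡ d → b ≡ b′ → (a , b) ≡ (a′ , b′)
pair-by-second {a = a} {b} {a′} b-a≡d b-a′≡d refl = cong (_, b) (begin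
  a                  ≡⟨ a≡b-[b-a] a b ⟩
  b ℤ.- (b ℤ.- a)    ≡⟨ cong (λ c → b ℤ.- c) (trans b-a≡d (sym b-a′≡d)) ⟩
  b ℤ.- (b ℤ.- a′)   ≡⟨ sym (a≡b-[b-a] a′ b) ⟩
  a′                 ∎)
  where
  a≡b-[b-a] : ∀ a b → a ≡ b ℤ.- (b ℤ.- a)
  a≡b-[b-a] = solve-∀

pair-opposite : ∀ {d a b a′ b′} → b ℤ.- a ≡ d → b′ ℤ.- a′ ≡ d → a ≡ ℤ.- b → a′ ≡ ℤ.- b′ →
                (a , b) ≡ (a′ , b′)
pair-opposite {b = b} {b′ = b′} b-a≡d b′-a′≡d refl refl = pair-by-second b-a≡d b′-a′≡d
  (ℤP.*-cancelˡ-≡ (+ 2) b b′ (trans (sym (b+b≡2b b)) (trans b-a≡d (trans (sym b′-a′≡d) (b+b≡2b b′)))))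
  where
  b+b≡2b : ∀ b → b ℤ.- ℤ.- b ≡ + 2 ℤ.* b
  b+b≡2b = solve-∀

plus×minus⇒3-smooth : ∀ {g u} → 2 ≤ u → SameRadical g (suc u) → SameRadical g (u ∸ 1) → 3-Smooth (g * u)
plus×minus⇒3-smooth {u = 1} (s≤s ()) _ _
plus×minus⇒3-smooth {g} {suc (suc v)} _ rad₊ rad₋ =
  subst (λ k → 3-Smooth (g * k)) (ℕP.+-comm (suc v) 1)
    (sameRadical-gap2⇒3-smooth (s≤s z≤n) rad₋ (subst (SameRadical g) (ℕP.+-comm 2 (suc v)) rad₊))

shape-unique : ∀ {g u x y} → 2 ≤ u → ¬ 3-Smooth (g * u) → Shape g u x → Shape g u y → x ≡ y
shape-unique _ _ (plus _)  (plus _)  = refl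
shape-unique _ _ (minus _) (minus _) = refl
shape-unique 2≤u ¬smooth (plus rad₊) (minus rad₋) = ⊥-elim (¬smooth (plus×minus⇒3-smooth 2≤u rad₊ rad₋))
shape-unique 2≤u ¬smooth (minus rad₋) (plus rad₊) = ⊥-elim (¬smooth (plus×minus⇒3-smooth 2≤u rad₊ rad₋))

powerPair-unique : ∀ {d x y} → ¬ 3-Smooth d → (P : PowerPair d x) (Q : PowerPair d y) →
                   PowerPair.g P ≡ PowerPair.g Q → x ≡ y
powerPair-unique ¬smooth
  record { g = g ; u = u ; 2≤g = 2≤g ; 2≤u = 2≤u ; d≡g*u = d≡g*u ; shape = shape }
  record { u = u′ ; d≡g*u = d≡g*u′ ; shape = shape′ } refl
  with ℕP.*-cancelˡ-≡ u u′ g {{ℕ.>-nonZero (ℕP.<⇒≤ 2≤g)}} (trans (sym d≡g*u) d≡g*u′)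
... | refl = shape-unique 2≤u (subst (λ d → ¬ 3-Smooth d) d≡g*u ¬smooth) shape shape′

powerPair-g≤1+u : ∀ {d x} → SquareFree d → (P : PowerPair d x) → PowerPair.g P ≤ suc (PowerPair.u P)
powerPair-g≤1+u sqf record { g = g ; u = u ; 2≤g = 2≤g ; 2≤u = 2≤u ; d≡g*u = d≡g*u ; shape = shape } = go shape
  where
  instance _ = ℕ.>-nonZero (ℕP.<⇒≤ 2≤g)
  sqf-g : SquareFree g
  sqf-g p pr p*p∣g = sqf p pr (∣-trans p*p∣g (divides u (trans d≡g*u (ℕP.*-comm g u))))
  go : ∀ {x} → Shape g u x → g ≤ suc u
  go (plus rad)  = ∣⇒≤ (squarefree-∣ sqf-g (λ p pr → proj₁ (rad p pr)))
  go (minus rad) = ℕP.≤-trans g≤u-1 (ℕP.≤-trans (ℕP.m∸n≤m u 1) (ℕP.n≤1+n u))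
    where
    g≤u-1 : g ≤ u ∸ 1
    g≤u-1 = ∣⇒≤ {{ℕ.>-nonZero (ℕP.∸-monoˡ-≤ 1 2≤u)}} (squarefree-∣ sqf-g (λ p pr → proj₁ (rad p pr)))

powerPair-g≢d : ∀ {d x} (P : PowerPair d x) → PowerPair.g P ≢ d
powerPair-g≢d record { g = g ; u = u ; 2≤g = 2≤g ; 2≤u = 2≤u ; d≡g*u = d≡g*u } g≡d =
  ℕP.<⇒≢ 2≤u (ℕP.*-cancelˡ-≡ 1 u g {{ℕ.>-nonZero (ℕP.<⇒≤ 2≤g)}}
    (trans (ℕP.*-identityʳ g) (trans g≡d d≡g*u)))

trivialLabel : ∀ {x} → ℕ → Trivial x → Maybe (Bool × ℕ)
trivialLabel _ (unitFirst s _)  = just (s , 1)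
trivialLabel d (unitSecond s _) = just (s , d)
trivialLabel _ (opposite _)     = nothing

divisorLabel : ∀ {d x} → Kind d x → Maybe (Bool × ℕ)
divisorLabel {d} (trivial τ) = trivialLabel d τ
divisorLabel     (power t P) = just (t , PowerPair.g P)

trivialLabel-injective : ∀ {d x y} → 1 < d → InM (+ d) x → InM (+ d) y →
                         (τ : Trivial x) (τ′ : Trivial y) → trivialLabel d τ ≡ trivialLabel d τ′ → x ≡ y
trivialLabel-injective {d} {a , b} {a′ , b′} 1<d (_ , b-a≡d) (_ , b′-a′≡d) = go
  where
  go : (τ : Trivial (a , b)) (τ′ : Trivial (a′ , b′)) → trivialLabel d τ ≡ trivialLabel d τ′ →
       (a , b) ≡ (a′ , b′)
  go (unitFirst s a≡±1)  (unitFirst .s a′≡±1)  refl = pair-by-first b-a≡d b′-a′≡d (trans a≡±1 (sym a′≡±1))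
  go (unitSecond s b≡±1) (unitSecond .s b′≡±1) refl = pair-by-second b-a≡d b′-a′≡d (trans b≡±1 (sym b′≡±1))
  go (opposite a≡-b)     (opposite a′≡-b′)     _    = pair-opposite b-a≡d b′-a′≡d a≡-b a′≡-b′
  go (unitFirst _ _)     (unitSecond _ _)      eq   = ⊥-elim (ℕP.<⇒≢ 1<d (proj₂ (,-injective (just-injective eq))))
  go (unitSecond _ _)    (unitFirst _ _)       eq   = ⊥-elim (ℕP.<⇒≢ 1<d (sym (proj₂ (,-injective (just-injective eq)))))
  go (unitFirst _ _)     (opposite _)          ()
  go (unitSecond _ _)    (opposite _)          ()
  go (opposite _)        (unitFirst _ _)       ()
  go (opposite _)        (unitSecond _ _)      ()

trivialLabel≢powerLabel : ∀ {d x y t} (τ : Trivial x) (P : PowerPair d y) → trivialLabel d τ ≢ just (t , PowerPair.g P)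
trivialLabel≢powerLabel (unitFirst _ _)  P eq = ℕP.<⇒≢ (PowerPair.2≤g P) (proj₂ (,-injective (just-injective eq)))
trivialLabel≢powerLabel (unitSecond _ _) P eq = powerPair-g≢d P (sym (proj₂ (,-injective (just-injective eq))))
trivialLabel≢powerLabel (opposite _)     P ()

divisorLabel-injective : ∀ {d x y} → 1 < d → ¬ 3-Smooth d → InM (+ d) x → InM (+ d) y →
                         (κ : Kind d x) (κ′ : Kind d y) → divisorLabel κ ≡ divisorLabel κ′ → x ≡ y
divisorLabel-injective 1<d _ x∈M y∈M (trivial τ) (trivial τ′) eq = trivialLabel-injective 1<d x∈M y∈M τ τ′ eq
divisorLabel-injective _ _ _ _ (trivial τ) (power _ Q) eq = ⊥-elim (trivialLabel≢powerLabel τ Q eq)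
divisorLabel-injective _ _ _ _ (power _ P) (trivial τ′) eq = ⊥-elim (trivialLabel≢powerLabel τ′ P (sym eq))
divisorLabel-injective _ ¬smooth _ _ (power t P) (power t′ Q) eq
  with refl ← proj₁ (,-injective (just-injective eq)) =
  orient-injective t (powerPair-unique ¬smooth P Q (proj₂ (,-injective (just-injective eq))))

-- Counting by injective keys

remove : ∀ {K : Set} {k : K} (ks : List K) → k ∈ ks → List K
remove (_ ∷ ks) (here _)  = ks
remove (k ∷ ks) (there p) = k ∷ remove ks p

length-remove : ∀ {K : Set} {k : K} (ks : List K) (k∈ks : k ∈ ks) → suc (length (remove ks k∈ks)) ≡ length ks
length-remove (_ ∷ ks) (here _)  = refl
length-remove (_ ∷ ks) (there p) = cong suc (length-remove ks p)

∈-remove : ∀ {K : Set} {k k′ : K} (ks : List K) (k∈ks : k ∈ ks) → k′ ∈ ks → k′ ≢ k → k′ ∈ remove ks k∈ks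
∈-remove (_ ∷ _)  (here refl) (here refl) k≢k = ⊥-elim (k≢k refl)
∈-remove (_ ∷ _)  (here refl) (there q)   _   = q
∈-remove (_ ∷ _)  (there p)   (here refl) _   = here refl
∈-remove (_ ∷ ks) (there p)   (there q)   k′≢k = there (∈-remove ks p q k′≢k)

module _ {A K : Set} {P : A → Set} (key : ∀ {x} → P x → K)
         (key-injective : ∀ {x y} (px : P x) (py : P y) → key px ≡ key py → x ≡ y) where

  Keyed : List K → A → Set
  Keyed ks x = Σ (P x) λ px → key px ∈ ks

  length≤keys : ∀ ks xs → Unique xs → All (Keyed ks) xs → length xs ≤ length ks
  length≤keys ks []       _              []                     = z≤n
  length≤keys ks (x ∷ xs) (x∉xs ∷ uniq) ((px , key∈ks) ∷ keyed) =
    ℕP.≤-trans (s≤s (length≤keys (remove ks key∈ks) xs uniq (keyed-remove xs x∉xs keyed)))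
               (ℕP.≤-reflexive (length-remove ks key∈ks))
    where
    keyed-remove : ∀ ys → All (x ≢_) ys → All (Keyed ks) ys → All (Keyed (remove ks key∈ks)) ys
    keyed-remove []       []              []                  = []
    keyed-remove (y ∷ ys) (x≢y ∷ x≢ys) ((py , ky∈ks) ∷ rest) =
      (py , ∈-remove ks key∈ks ky∈ks (λ ky≡kx → x≢y (key-injective px py (sym ky≡kx))))
      ∷ keyed-remove ys x≢ys rest

  length≤byKeys : ∀ (ks : List K) → (∀ {x} (px : P x) → key px ∈ ks) →
                  ∀ (xs : List A) → Unique xs → All P xs → length xs ≤ length ks
  length≤byKeys ks key∈ks xs uniq all = length≤keys ks xs uniq (All.map (λ px → px , key∈ks px) all)

bitStrings : ℕ → List (List Bool)
bitStrings zero    = [] ∷ []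
bitStrings (suc n) = map (true ∷_) (bitStrings n) ++ map (false ∷_) (bitStrings n)

∈-bitStrings : ∀ bs → bs ∈ bitStrings (length bs)
∈-bitStrings []           = here refl
∈-bitStrings (true ∷ bs)  = ∈-++⁺ˡ (∈-map⁺ (true ∷_) (∈-bitStrings bs))
∈-bitStrings (false ∷ bs) = ∈-++⁺ʳ (map (true ∷_) (bitStrings (length bs))) (∈-map⁺ (false ∷_) (∈-bitStrings bs))

length-bitStrings : ∀ n → length (bitStrings n) ≡ 2 ^ n
length-bitStrings zero    = refl
length-bitStrings (suc n) = begin
  length (map (true ∷_) B ++ map (false ∷_) B)          ≡⟨ ListP.length-++ (map (true ∷_) B) ⟩
  length (map (true ∷_) B) + length (map (false ∷_) B)  ≡⟨ cong₂ _+_ (ListP.length-map _ B) (ListP.length-map _ B) ⟩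
  length B + length B                                   ≡⟨ cong₂ _+_ (length-bitStrings n) (length-bitStrings n) ⟩
  2 ^ n + 2 ^ n                                         ≡⟨ cong (λ k → 2 ^ n + k) (sym (ℕP.+-identityʳ (2 ^ n))) ⟩
  2 ^ suc n                                             ∎
  where B = bitStrings n

-- A pair {bs, map not bs} of complementary bit strings is coded by the member with leading
-- bit false, stripped of that bit.
pairCode : List Bool → List Bool
pairCode []           = []
pairCode (false ∷ bs) = bs
pairCode (true ∷ bs)  = map not bs

length-pairCode : ∀ bs → length (pairCode bs) ≡ ℕ.pred (length bs)
length-pairCode []           = refl
length-pairCode (false ∷ bs) = refl
length-pairCode (true ∷ bs)  = ListP.length-map not bs

map-not-involutive : ∀ bs → map not (map not bs) ≡ bs
map-not-involutive bs = trans (sym (ListP.map-∘ bs)) (trans (ListP.map-cong BoolP.not-involutive bs) (ListP.map-id bs))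

pairCode-injective : ∀ {bs bs′} → length bs ≡ length bs′ → pairCode bs ≡ pairCode bs′ →
                     bs ≡ bs′ ⊎ bs′ ≡ map not bs
pairCode-injective {[]}         {[]}          _ _  = inj₁ refl
pairCode-injective {false ∷ bs} {false ∷ bs′} _ eq = inj₁ (cong (false ∷_) eq)
pairCode-injective {true ∷ bs}  {true ∷ bs′}  _ eq =
  inj₁ (cong (true ∷_) (trans (sym (map-not-involutive bs)) (trans (cong (map not) eq) (map-not-involutive bs′))))
pairCode-injective {false ∷ bs} {true ∷ bs′}  _ eq =
  inj₂ (cong (true ∷_) (trans (sym (map-not-involutive bs′)) (cong (map not) (sym eq))))
pairCode-injective {true ∷ bs}  {false ∷ bs′} _ eq = inj₂ (cong (false ∷_) (sym eq))

-- Unitary divisors and their prime supports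

UnitaryFactorisation : ℕ → ℕ → ℕ → Set
UnitaryFactorisation d g u = g * u ≡ d × Coprime g u

unitary-sym : ∀ {d g u} → UnitaryFactorisation d g u → UnitaryFactorisation d u g
unitary-sym {g = g} {u} (g*u≡d , coprime) = trans (ℕP.*-comm u g) g*u≡d , Coprime.sym coprime

PrimeDivisorList : ℕ → List ℕ → Set
PrimeDivisorList n ps = (p : ℕ) → (p ∈ ps → Prime p × p ∣ n) × (Prime p × p ∣ n → p ∈ ps)

map-pointwise : ∀ {A B : Set} (f g : A → B) {xs x} → map f xs ≡ map g xs → x ∈ xs → f x ≡ g x
map-pointwise f g {_ ∷ _}  eq (here refl) = proj₁ (ListP.∷-injective eq)
map-pointwise f g {_ ∷ xs} eq (there x∈xs) = map-pointwise f g (proj₂ (ListP.∷-injective eq)) x∈xs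

does-true⇒ : ∀ {A : Set} (a? : Dec A) → does a? ≡ true → A
does-true⇒ (yes a) _ = a

module Support {d : ℕ} (1≤d : 1 ≤ d) (ps : List ℕ) (primeDivisors : PrimeDivisorList d ps) where

  support : ℕ → List Bool
  support x = map (λ p → does (p ∣? x)) ps

  none : List Bool
  none = map (λ _ → false) ps

  support-∣ : ∀ {p x y} → p ∈ ps → support x ≡ support y → p ∣ x → p ∣ y
  support-∣ {p} {x} {y} p∈ps eq p∣x =
    does-true⇒ (p ∣? y) (trans (sym (map-pointwise _ _ eq p∈ps)) (dec-true (p ∣? x) p∣x))

  prime∣d⇒∈ : ∀ {p} → Prime p → p ∣ d → p ∈ ps
  prime∣d⇒∈ pr p∣d = proj₂ (primeDivisors _) (pr , p∣d)

  ∈⇒prime : ∀ {p} → p ∈ ps → Prime p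
  ∈⇒prime p∈ps = proj₁ (proj₁ (primeDivisors _) p∈ps)

  unitary-∣ : ∀ {g u g′ u′} → UnitaryFactorisation d g u → UnitaryFactorisation d g′ u′ →
              support g ≡ support g′ → g ∣ g′
  unitary-∣ {g} {u} {g′} {u′} (g*u≡d , _) (g′*u′≡d , coprime′) eq =
    coprime-divisor g⊥u′ (subst (g ∣_) (trans (sym g′*u′≡d) (ℕP.*-comm g′ u′)) g∣d)
    where
    g∣d : g ∣ d
    g∣d = divides u (trans (sym g*u≡d) (ℕP.*-comm g u))
    prime∣g⇒∣g′ : ∀ {p} → Prime p → p ∣ g → p ∣ g′
    prime∣g⇒∣g′ pr p∣g = support-∣ (prime∣d⇒∈ pr (∣-trans p∣g g∣d)) eq p∣g
    g⊥u′ : Coprime g u′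
    g⊥u′ = noCommonPrime⇒coprime (ℕP.n≢0⇒n>0 λ { refl → ℕP.<⇒≢ 1≤d g*u≡d })
      λ p pr p∣g p∣u′ → prime∤1 pr (subst (p ∣_) (coprime′ (prime∣g⇒∣g′ pr p∣g , p∣u′)) ∣-refl)

  support-injective : ∀ {g u g′ u′} → UnitaryFactorisation d g u → UnitaryFactorisation d g′ u′ →
                      support g ≡ support g′ → g ≡ g′
  support-injective ug ug′ eq = ∣-antisym (unitary-∣ ug ug′ eq) (unitary-∣ ug′ ug (sym eq))

  support-complement : ∀ {g u} → UnitaryFactorisation d g u → support u ≡ map not (support g)
  support-complement {g} {u} (g*u≡d , coprime) =
    trans (ListP.map-cong-local (All.tabulate complement)) (ListP.map-∘ ps)
    where
    complement : ∀ {p} → p ∈ ps → does (p ∣? u) ≡ not (does (p ∣? g))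
    complement {p} p∈ps with p ∣? g | p ∣? u
    ... | yes p∣g | yes p∣u = ⊥-elim (prime∤1 (∈⇒prime p∈ps) (subst (p ∣_) (coprime (p∣g , p∣u)) ∣-refl))
    ... | yes _   | no _    = refl
    ... | no _    | yes _   = refl
    ... | no p∤g  | no p∤u  with euclidsLemma g u (∈⇒prime p∈ps)
                                   (subst (p ∣_) (sym g*u≡d) (proj₂ (proj₁ (primeDivisors p) p∈ps)))
    ...   | inj₁ p∣g = ⊥-elim (p∤g p∣g)
    ...   | inj₂ p∣u = ⊥-elim (p∤u p∣u)

  support≢none : ∀ {x} → 2 ≤ x → x ∣ d → support x ≢ none
  support≢none {x} 2≤x x∣d eq with primeFactor x 2≤x
  ... | p , pr , p∣x with () ← trans (sym (dec-true (p ∣? x) p∣x))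
                                (map-pointwise _ _ eq (prime∣d⇒∈ pr (∣-trans p∣x x∣d)))

module Counting {d : ℕ} (1<d : 1 < d) (¬smooth : ¬ 3-Smooth d) (ps : List ℕ) (primeDivisors : PrimeDivisorList d ps) where

  1≤d : 1 ≤ d
  1≤d = ℕP.<⇒≤ 1<d

  open Support 1≤d ps primeDivisors public

  kind : ∀ {x} → InM (+ d) x → Kind d x
  kind {x} = classify x 1≤d ¬smooth

  countByKey : ∀ {K : Set} (key : ∀ {x} → Kind d x → K) →
               (∀ {x y} (κ : Kind d x) (κ′ : Kind d y) → key κ ≡ key κ′ → divisorLabel κ ≡ divisorLabel κ′) →
               (ks : List K) → (∀ {x} (κ : Kind d x) → key κ ∈ ks) → CardAtMost (length ks) (InM (+ d))
  countByKey key key-injective ks key∈ks =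
    length≤byKeys (λ {x} x∈M → key (kind {x} x∈M))
      (λ x∈M y∈M eq → divisorLabel-injective 1<d ¬smooth x∈M y∈M (kind x∈M) (kind y∈M)
                        (key-injective (kind x∈M) (kind y∈M) eq))
      ks (λ {x} x∈M → key∈ks (kind {x} x∈M))

  LabelUnitary : Maybe (Bool × ℕ) → Set
  LabelUnitary nothing        = ⊤
  LabelUnitary (just (_ , g)) = ∃ λ u → UnitaryFactorisation d g u

  divisorLabel-unitary : ∀ {x} (κ : Kind d x) → LabelUnitary (divisorLabel κ)
  divisorLabel-unitary (trivial (unitFirst _ _))  = d , ℕP.+-identityʳ d , Coprime.1-coprimeTo d
  divisorLabel-unitary (trivial (unitSecond _ _)) = 1 , ℕP.*-identityʳ d , Coprime.sym (Coprime.1-coprimeTo d)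
  divisorLabel-unitary (trivial (opposite _))     = tt
  divisorLabel-unitary (power _ P)                = PowerPair.u P , sym (PowerPair.d≡g*u P) , PowerPair.coprime P

  encode : Maybe (Bool × ℕ) → Maybe (List Bool)
  encode nothing        = nothing
  encode (just (t , g)) = just (t ∷ support g)

  encode-injective : ∀ l l′ → LabelUnitary l → LabelUnitary l′ → encode l ≡ encode l′ → l ≡ l′
  encode-injective nothing        nothing          _         _          _  = refl
  encode-injective (just (t , g)) (just (t′ , g′)) (_ , ug) (_ , ug′) eq
    with refl , support≡ ← ListP.∷-injective (just-injective eq) =
    cong (λ g → just (t , g)) (support-injective ug ug′ support≡)

  generalBound : CardAtMost (2 ^ (length ps + 1) + 1) (InM (+ d))
  generalBound = subst (λ n → CardAtMost n (InM (+ d))) length-keys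
    (countByKey (encode ∘ divisorLabel)
      (λ κ κ′ → encode-injective _ _ (divisorLabel-unitary κ) (divisorLabel-unitary κ′))
      keys (λ κ → encode∈keys (divisorLabel κ)))
    where
    keys : List (Maybe (List Bool))
    keys = nothing ∷ map just (bitStrings (suc (length ps)))
    length-keys : length keys ≡ 2 ^ (length ps + 1) + 1
    length-keys = trans (cong suc (trans (ListP.length-map just (bitStrings (suc (length ps))))
                                         (length-bitStrings (suc (length ps)))))
                        (trans (ℕP.+-comm 1 _) (cong (λ n → 2 ^ n + 1) (ℕP.+-comm 1 (length ps))))
    encode∈keys : ∀ l → encode l ∈ keys
    encode∈keys nothing        = here refl
    encode∈keys (just (t , g)) = there (∈-map⁺ just
      (subst (λ n → t ∷ support g ∈ bitStrings (suc n)) (ListP.length-map _ ps) (∈-bitStrings (t ∷ support g))))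

  module _ (squarefree : SquareFree d) where

    unitary : ∀ {x} (P : PowerPair d x) → UnitaryFactorisation d (PowerPair.g P) (PowerPair.u P)
    unitary P = sym (PowerPair.d≡g*u P) , PowerPair.coprime P

    support≢none-g : ∀ {x} (P : PowerPair d x) → support (PowerPair.g P) ≢ none
    support≢none-g P = support≢none (PowerPair.2≤g P)
      (divides (PowerPair.u P) (trans (PowerPair.d≡g*u P) (ℕP.*-comm (PowerPair.g P) (PowerPair.u P))))

    support≢none-u : ∀ {x} (P : PowerPair d x) → support (PowerPair.u P) ≢ none
    support≢none-u P = support≢none (PowerPair.2≤u P) (divides (PowerPair.g P) (PowerPair.d≡g*u P))

    pairCode≢trivial : ∀ {x} (P : PowerPair d x) → pairCode (support (PowerPair.g P)) ≢ pairCode none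
    pairCode≢trivial P eq with pairCode-injective (trans (ListP.length-map _ ps) (sym (ListP.length-map _ ps))) eq
    ... | inj₁ g-none   = support≢none-g P g-none
    ... | inj₂ none-¬g  = support≢none-u P (trans (support-complement (unitary P)) (sym none-¬g))

    -- When g = u + 1 both g and u occur as divisors of power pairs; g then takes the code of the
    -- trivial pair {1, d}, which no power pair uses.
    powerCode : ∀ {x} → PowerPair d x → List Bool
    powerCode P with PowerPair.g P ℕ.≟ suc (PowerPair.u P)
    ... | yes _ = pairCode none
    ... | no _  = pairCode (support (PowerPair.g P))

    swapped-impossible : ∀ {x y} (P : PowerPair d x) (Q : PowerPair d y) →
                         PowerPair.g P ≢ suc (PowerPair.u P) → PowerPair.g Q ≢ suc (PowerPair.u Q) →
                         support (PowerPair.g Q) ≡ support (PowerPair.u P) → ⊥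
    swapped-impossible P@record { g = g ; u = u ; 2≤g = 2≤g ; 2≤u = 2≤u ; d≡g*u = d≡g*u ; coprime = coprime }
                       Q@record { g = g′ ; u = u′ ; d≡g*u = d≡g′*u′ } g≢1+u g′≢1+u′ supp
      with support-injective (unitary Q) (unitary-sym (unitary P)) supp
    ... | refl = ℕP.<⇒≢ 2≤g (sym (coprime (∣-refl , subst (g ∣_) g≡u ∣-refl)))
      where
      u′≡g : u′ ≡ g
      u′≡g = ℕP.*-cancelˡ-≡ u′ g u {{ℕ.>-nonZero (ℕP.<⇒≤ 2≤u)}}
               (trans (sym d≡g′*u′) (trans d≡g*u (ℕP.*-comm g u)))
      g≡u : g ≡ u
      g≡u = within-one⇒≡ (powerPair-g≤1+u squarefree P) g≢1+u
              (subst (λ k → u ≤ suc k) u′≡g (powerPair-g≤1+u squarefree Q))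
              (subst (λ k → u ≢ suc k) u′≡g g′≢1+u′)

    powerCode-injective : ∀ {x y} (P : PowerPair d x) (Q : PowerPair d y) →
                          powerCode P ≡ powerCode Q → PowerPair.g P ≡ PowerPair.g Q
    powerCode-injective P Q eq with PowerPair.g P ℕ.≟ suc (PowerPair.u P) | PowerPair.g Q ℕ.≟ suc (PowerPair.u Q)
    ... | yes g≡1+u | yes g′≡1+u′ = trans g≡1+u (trans (cong suc u≡u′) (sym g′≡1+u′))
      where
      u≡u′ : PowerPair.u P ≡ PowerPair.u Q
      u≡u′ = suc[m]*m-injective (trans (cong (ℕ._* PowerPair.u P) (sym g≡1+u))
               (trans (sym (PowerPair.d≡g*u P)) (trans (PowerPair.d≡g*u Q) (cong (ℕ._* PowerPair.u Q) g′≡1+u′))))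
    ... | yes _ | no _ = ⊥-elim (pairCode≢trivial Q (sym eq))
    ... | no _  | yes _ = ⊥-elim (pairCode≢trivial P eq)
    ... | no g≢1+u | no g′≢1+u′
      with pairCode-injective (trans (ListP.length-map _ ps) (sym (ListP.length-map _ ps))) eq
    ...   | inj₁ supports≡ = support-injective (unitary P) (unitary Q) supports≡
    ...   | inj₂ swapped   = ⊥-elim (swapped-impossible P Q g≢1+u g′≢1+u′
                                        (trans swapped (sym (support-complement (unitary P)))))

    length-powerCode : ∀ {x} (P : PowerPair d x) → length (powerCode P) ≡ length (pairCode none)
    length-powerCode P with PowerPair.g P ℕ.≟ suc (PowerPair.u P)
    ... | yes _ = refl
    ... | no _  = trans (length-pairCode (support (PowerPair.g P)))
                    (trans (cong ℕ.pred (trans (ListP.length-map _ ps) (sym (ListP.length-map _ ps))))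
                           (sym (length-pairCode none)))

    squarefreeKey : ∀ {x} → Kind d x → Maybe (Bool × ℕ) ⊎ List Bool
    squarefreeKey (trivial τ) = inj₁ (trivialLabel d τ)
    squarefreeKey (power t P) = inj₂ (t ∷ powerCode P)

    squarefreeKey-injective : ∀ {x y} (κ : Kind d x) (κ′ : Kind d y) →
                              squarefreeKey κ ≡ squarefreeKey κ′ → divisorLabel κ ≡ divisorLabel κ′
    squarefreeKey-injective (trivial _) (trivial _) eq = SumP.inj₁-injective eq
    squarefreeKey-injective (power t P) (power _ Q) eq with refl , codes ← ListP.∷-injective (SumP.inj₂-injective eq) =
      cong (λ g → just (t , g)) (powerCode-injective P Q codes)
    squarefreeKey-injective (trivial _) (power _ _) ()
    squarefreeKey-injective (power _ _) (trivial _) ()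

    squarefreeBound : CardAtMost (5 + 2 ^ suc (ℕ.pred (length ps))) (InM (+ d))
    squarefreeBound = subst (λ n → CardAtMost (5 + 2 ^ suc n) (InM (+ d)))
      (trans (length-pairCode none) (cong ℕ.pred (ListP.length-map _ ps)))
      (subst (λ n → CardAtMost n (InM (+ d))) length-keys
        (countByKey squarefreeKey squarefreeKey-injective keys key∈keys))
      where
      n = length (pairCode none)
      trivialLabels : List (Maybe (Bool × ℕ))
      trivialLabels = nothing ∷ just (true , 1) ∷ just (false , 1) ∷ just (true , d) ∷ just (false , d) ∷ []
      keys : List (Maybe (Bool × ℕ) ⊎ List Bool)
      keys = map inj₁ trivialLabels ++ map inj₂ (bitStrings (suc n))
      length-keys : length keys ≡ 5 + 2 ^ suc n
      length-keys = trans (ListP.length-++ (map inj₁ trivialLabels) {map inj₂ (bitStrings (suc n))})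
        (cong (5 ℕ.+_) (trans (ListP.length-map inj₂ (bitStrings (suc n))) (length-bitStrings (suc n))))
      trivialLabel∈ : ∀ {x} (τ : Trivial x) → trivialLabel d τ ∈ trivialLabels
      trivialLabel∈ (opposite _)         = here refl
      trivialLabel∈ (unitFirst true _)   = there (here refl)
      trivialLabel∈ (unitFirst false _)  = there (there (here refl))
      trivialLabel∈ (unitSecond true _)  = there (there (there (here refl)))
      trivialLabel∈ (unitSecond false _) = there (there (there (there (here refl))))
      key∈keys : ∀ {x} (κ : Kind d x) → squarefreeKey κ ∈ keys
      key∈keys (trivial τ) = ∈-++⁺ˡ (∈-map⁺ inj₁ (trivialLabel∈ τ))
      key∈keys (power t P) = ∈-++⁺ʳ (map inj₁ trivialLabels) (∈-map⁺ inj₂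
        (subst (λ k → t ∷ powerCode P ∈ bitStrings (suc k)) (length-powerCode P) (∈-bitStrings (t ∷ powerCode P))))

3-smooth⇒≤2-primes : ∀ {d ps} → Unique ps → PrimeDivisorList d ps → 3-Smooth d → length ps ≤ 2
3-smooth⇒≤2-primes {ps = ps} uniq primeDivisors smooth =
  length≤byKeys {P = λ p → p ≡ 2 ⊎ p ≡ 3} (λ {p} _ → p) (λ _ _ eq → eq) (2 ∷ 3 ∷ []) 2-or-3 ps uniq
    (All.tabulate λ p∈ps → let pr , p∣d = proj₁ (primeDivisors _) p∈ps in smooth _ pr p∣d)
  where
  2-or-3 : ∀ {p} → p ≡ 2 ⊎ p ≡ 3 → p ∈ 2 ∷ 3 ∷ []
  2-or-3 (inj₁ refl) = here refl
  2-or-3 (inj₂ refl) = there (here refl)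

4*m≤2^m+2 : ∀ k → 4 * (4 + k) ≤ 2 ^ (4 + k) + 2
4*m≤2^m+2 zero    = ℕP.m≤m+n 16 2
4*m≤2^m+2 (suc k) = subst (_≤ 2 ^ (5 + k) + 2) (sym (ℕP.*-suc 4 (4 + k)))
  (ℕP.≤-trans (ℕP.+-mono-≤ 4≤2^m (4*m≤2^m+2 k))
              (ℕP.≤-reflexive (trans (sym (ℕP.+-assoc (2 ^ (4 + k)) _ 2))
                                     (cong (λ y → 2 ^ (4 + k) + y + 2) (sym (ℕP.+-identityʳ _))))))
  where
  4≤2^m : 4 ≤ 2 ^ (4 + k)
  4≤2^m = ℕP.^-monoʳ-≤ 2 {2} {4 + k} (s≤s (s≤s z≤n))

squarefree-estimate : ∀ m → 4 ≤ m → 5 + 2 ^ m ≤ 2 ^ (m + 1) + 7 ∸ 4 * m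
squarefree-estimate m 4≤m with ℕP.m≤n⇒∃[o]m+o≡n 4≤m
... | k , refl =
  ℕP.m+n≤o⇒m≤o∸n (5 + X) (ℕP.≤-trans (ℕP.+-monoʳ-≤ (5 + X) (4*m≤2^m+2 k)) (ℕP.≤-reflexive rearrange))
  where
  X = 2 ^ (4 + k)
  rearrange : 5 + X + (X + 2) ≡ 2 ^ (4 + k + 1) + 7
  rearrange = trans (identity X) (cong (λ n → 2 ^ n + 7) (ℕP.+-comm 1 (4 + k)))
    where
    identity : ∀ X → 5 + X + (X + 2) ≡ X + (X + 0) + 7
    identity = ℕSolver.solve-∀

¬3-smooth⇒1<d : ∀ {d} → 0 < d → ¬ 3-Smooth d → 1 < d
¬3-smooth⇒1<d {suc zero}    _ ¬smooth = ⊥-elim (¬smooth λ p pr p∣1 → ⊥-elim (prime∤1 pr p∣1))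
¬3-smooth⇒1<d {suc (suc _)} _ _       = s≤s (s≤s z≤n)

cardAtMost-weaken : ∀ {N N′ P} → N ≤ N′ → CardAtMost N P → CardAtMost N′ P
cardAtMost-weaken N≤N′ card xs uniq all = ℕP.≤-trans (card xs uniq all) N≤N′

theorem4p4 : (d m : ℕ) → 0 < d → 2 ∣ d → 3 ≤ m → HasDistinctPrimeFactors d m →
    CardAtMost (2 ^ (m + 1) + 1) (InM (+ d)) ×
    (SquareFree d →
      (m ≡ 3 → CardAtMost 13 (InM (+ d))) ×
      (4 ≤ m → CardAtMost (2 ^ (m + 1) + 7 ∸ 4 * m) (InM (+ d))))
theorem4p4 d m _ _ () ([] , _ , refl , _)
theorem4p4 d m 0<d _ 3≤m (ps@(_ ∷ _) , uniq , refl , primeDivisors) =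
  generalBound , λ squarefree →
    (λ m≡3 → subst (λ k → CardAtMost (5 + 2 ^ k) (InM (+ d))) m≡3 (squarefreeBound squarefree)) ,
    (λ 4≤m → cardAtMost-weaken (squarefree-estimate m 4≤m) (squarefreeBound squarefree))
  where
  ¬smooth : ¬ 3-Smooth d
  ¬smooth smooth = ℕP.<⇒≱ 3≤m (3-smooth⇒≤2-primes uniq primeDivisors smooth)
  open Counting (¬3-smooth⇒1<d 0<d ¬smooth) ¬smooth ps primeDivisors
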